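{- Let $D=(G,\mathcal{O},w)$ be a weighted oriented graph, let $(z,y),(y,x)\in E(D)$ with $y\in V^{+}$, and write $N_D(x)=\{y,x_1,\dots,x_s\}$. If there are $z_i\in N_D(x_i)\setminus N_D^{+}(y)$ ($i=1,\dots,s$) such that $\{z,x,z_1,\dots,z_s\}$ is a stable set of $G$, then $I(D)$ is not unmixed.
   Context: A weighted oriented graph is a triple $D=(G,\mathcal{O},w)$ with $G$ a finite simple graph with vertex set $\{x_1,\dots,x_n\}$ (as variables), $\mathcal{O}$ an orientation of its edges, $w:V(G)\to\mathbb{N}$; $E(D)$ is the set of oriented edges. $V^{+}=\{x\mid w(x)>1\}$. $I(D)=(x_ix_j^{w(x_j)}\mid (x_i,x_j)\in E(D))$ in a polynomial ring over a field; unmixed means all associated primes have the same height. $N_D^{+}(x)=\{u\mid(x,u)\in E(D)\}$, $N_D^{ - }(x)=\{u\mid(u,x)\in E(D)\}$, $N_D(x)=N_D^+(x)\cup N_D^-(x)$. Standing convention: every source (vertex with no incoming edge) has weight $1$. -}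

module Defs where

open import Data.Nat using (ℕ; _≤_; _<_; _+_)
open import Data.Fin using (Fin)
open import Data.Fin.Subset using (Subset; _∈_; ∣_∣)
open import Data.Bool using (Bool; true; false)
open import Data.Product using (Σ; ∃; ∃-syntax; _×_)
open import Data.Sum using (_⊎_)
open import Relation.Binary.PropositionalEquality using (_≡_; _≢_)
open import Relation.Nullary using (¬_)

-- A weighted oriented graph on the vertex set {x_0,...,x_{n-1}} = Fin n.
-- arc i j ≡ true  means (x_i , x_j) ∈ E(D).
record WOG (n : ℕ) : Set where
  field
    arc     : Fin n → Fin n → Bool
    weight  : Fin n → ℕ
    irrefl  : ∀ i → arc i i ≡ false
    oneway  : ∀ i j → arc i j ≡ true → arc j i ≡ false
    wpos    : ∀ i → 1 ≤ weight i
    -- standing convention: every source has weight 1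
    sourceW : ∀ i → (∀ j → arc j i ≡ false) → weight i ≡ 1

module _ {n : ℕ} (D : WOG n) where
  open WOG D

  Arc : Fin n → Fin n → Set
  Arc i j = arc i j ≡ true

  Adj : Fin n → Fin n → Set
  Adj i j = Arc i j ⊎ Arc j i

  InVplus : Fin n → Set
  InVplus v = 1 < weight v

  -- Monomials in x_0..x_{n-1} as exponent vectors.
  Monomial : Set
  Monomial = Fin n → ℕ

  _·_ : Monomial → Monomial → Monomial
  (u · m) i = u i + m i

  -- A monomial lies in I(D) = (x_i x_j^{w(x_j)} | (x_i,x_j) ∈ E(D))
  -- iff it is divisible by one of the generators.
  InI : Monomial → Set
  InI u = ∃[ i ] ∃[ j ] (Arc i j × (1 ≤ u i) × (weight j ≤ u j))

  -- A monomial lies in the prime P_A = (x_i | i ∈ A).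
  InP : Subset n → Monomial → Set
  InP A u = ∃[ i ] (i ∈ A × 1 ≤ u i)

  -- P_A is an associated prime of I(D): P_A = (I(D) : m) for a monomial m
  -- (both sides are monomial ideals, so equality is tested on monomials).
  Ass : Subset n → Set
  Ass A = ∃[ m ] (∀ (u : Monomial) → (InI (u · m) → InP A u) × (InP A u → InI (u · m)))

  -- unmixed: all associated primes have the same height (ht P_A = |A|)
  Unmixed : Set
  Unmixed = ∀ A B → Ass A → Ass B → ∣ A ∣ ≡ ∣ B ∣

  -- stable set condition of the lemma: S = {z, x} ∪ {f v | v ∈ N_D(x), v ≠ y}
  InS : (z x y : Fin n) (f : Fin n → Fin n) → Fin n → Set
  InS z x y f v = v ≡ z ⊎ v ≡ x ⊎ ∃[ u ] (Adj x u × u ≢ y × f u ≡ v)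

  Stable : (Fin n → Set) → Set
  Stable S = ∀ u v → S u → S v → ¬ Adj u v

-- A strong vertex cover C of D yields the associated prime P_C = (I(D) : m) of
-- I(D), for an explicit monomial m.  Extend the stable set {z, x, z₁, …, zₛ} to a
-- stable set S₁ maximal among the vertices outside N⁺(y), and S₁ to a maximal
-- stable set S₂, whose complement is a minimal, hence strong, vertex cover.  For
-- T = S₁ ∖ {x} the complement is strong as well: a neighbour of x sees z or some
-- zᵢ in T, so a vertex outside T with no neighbour in T is x or lies in N⁺(y);
-- either way it is entered from y ∈ V⁺, none of whose out-neighbours lies in T.
-- As T ⊊ S₂, the two covers have different heights.
module Submission where

open import Defs
open import Data.Nat using (ℕ; zero; suc; _≤_; _<_; _+_; _∸_; z≤n; s≤s)
open import Data.Nat.Properties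
  using (<⇒≱; <-irrefl; ≤-trans; m≤m+n; m≤n+m; m≤n+m∸n; +-monoˡ-≤; +-identityʳ; ∸-monoʳ-<; m<n⇒0<n∸m)
open import Data.Fin using (Fin; _≟_)
open import Data.Fin.Properties using (any?)
open import Data.Fin.Subset
  using (Subset; inside; outside; _∈_; _∉_; _⊆_; _⊂_; ∁; _∪_; _─_; _-_; ⁅_⁆)
open import Data.Fin.Subset.Properties
  using (_∈?_; x∈⁅x⁆; x∈⁅y⁆⇒x≡y; x∉⁅y⁆⇒x≢y; x∈p∪q⁻; p⊆p∪q; q⊆p∪q; p─q⊆p; x∈p∧x≢y⇒x∈p-y;
         x∈p⇒p-x⊂p; ⊂-⊆-trans; p⊂q⇒∁p⊃∁q; p⊂q⇒∣p∣<∣q∣; x∉p⇒x∈∁p; x∈∁p⇒x∉p)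
open import Data.Bool using (true; false)
import Data.Bool as Bool
open import Data.Bool.Properties using (T-≡)
open import Data.Vec using (_∷_; there; tabulate)
open import Data.Vec.Properties using (lookup∘tabulate; []=⇒lookup; lookup⇒[]=)
open import Data.List using (List; []; _∷_; allFin; filter)
open import Data.List.Membership.Propositional using () renaming (_∈_ to _∈ₗ_)
open import Data.List.Membership.Propositional.Properties using (∈-allFin; ∈-filter⁺; ∈-filter⁻)
open import Data.List.Relation.Unary.Any using (here; there)
open import Data.Product using (∃-syntax; _×_; _,_; proj₂)
open import Data.Sum using (_⊎_; inj₁; inj₂; swap)
import Data.Sum as Sum
open import Function using (_∘_; id)
open import Function.Bundles using (Equivalence)
open import Relation.Binary.PropositionalEquality using (_≡_; _≢_; refl; sym; trans; cong; subst)
open import Relation.Nullary using (¬_; Dec; yes; no; contradiction; ¬?)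
open import Relation.Nullary.Decidable using (isYes; toWitness; fromWitness; _×-dec_; _⊎-dec_)
open import Relation.Unary using (Pred; Decidable)

m<n⇒n≤o+m⇒0<o : ∀ {m n o} → m < n → n ≤ o + m → 0 < o
m<n⇒n≤o+m⇒0<o {o = zero}  m<n n≤m = contradiction n≤m (<⇒≱ m<n)
m<n⇒n≤o+m⇒0<o {o = suc _} _   _   = s≤s z≤n

x∈p─q⇒x∉q : ∀ {n} {x : Fin n} (p q : Subset n) → x ∈ p ─ q → x ∉ q
x∈p─q⇒x∉q (_ ∷ p) (outside ∷ q) (there x∈p─q) (there x∈q) = x∈p─q⇒x∉q p q x∈p─q x∈q
x∈p─q⇒x∉q (_ ∷ p) (inside  ∷ q) (there x∈p─q) (there x∈q) = x∈p─q⇒x∉q p q x∈p─q x∈q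

module _ {n : ℕ} where

  x∈p-y⇒x≢y : ∀ {x y : Fin n} {p : Subset n} → x ∈ p - y → x ≢ y
  x∈p-y⇒x≢y {y = y} {p} = x∉⁅y⁆⇒x≢y ∘ x∈p─q⇒x∉q p ⁅ y ⁆

  toSubset : ∀ {ℓ} {P : Pred (Fin n) ℓ} → Decidable P → Subset n
  toSubset P? = tabulate (isYes ∘ P?)

  module _ {ℓ} {P : Pred (Fin n) ℓ} {P? : Decidable P} {x : Fin n} where

    ∈-toSubset⁻ : x ∈ toSubset P? → P x
    ∈-toSubset⁻ x∈ =
      toWitness (Equivalence.from T-≡ (trans (sym (lookup∘tabulate _ x)) ([]=⇒lookup x∈)))

    ∈-toSubset⁺ : P x → x ∈ toSubset P?
    ∈-toSubset⁺ Px =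
      lookup⇒[]= x _ (trans (lookup∘tabulate _ x) (Equivalence.to T-≡ (fromWitness Px)))

module _ {n : ℕ} (D : WOG n) where
  open WOG D

  arc? : ∀ i j → Dec (Arc D i j)
  arc? i j = arc i j Bool.≟ true

  adj? : ∀ i j → Dec (Adj D i j)
  adj? i j = arc? i j ⊎-dec arc? j i

  ¬Arc : ∀ {i j} → arc i j ≡ false → ¬ Arc D i j
  ¬Arc i↛j i→j with () ← trans (sym i↛j) i→j

  adj-irrefl : ∀ {i} → ¬ Adj D i i
  adj-irrefl {i} (inj₁ i→i) = ¬Arc (irrefl i) i→i
  adj-irrefl {i} (inj₂ i→i) = ¬Arc (irrefl i) i→i

  Stable-⊆ : ∀ {P Q : Fin n → Set} → (∀ {v} → P v → Q v) → Stable D Q → Stable D P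
  Stable-⊆ P⊆Q Q-stable u v Pu Pv = Q-stable u v (P⊆Q Pu) (P⊆Q Pv)

  HasNeighbourIn : Subset n → Fin n → Set
  HasNeighbourIn S v = ∃[ j ] (Adj D v j × j ∈ S)

  HasOutNeighbourIn : Subset n → Fin n → Set
  HasOutNeighbourIn S v = ∃[ j ] (Arc D v j × j ∈ S)

  hasNeighbourIn? : ∀ S → Decidable (HasNeighbourIn S)
  hasNeighbourIn? S v = any? λ j → adj? v j ×-dec j ∈? S

  hasOutNeighbourIn? : ∀ S → Decidable (HasOutNeighbourIn S)
  hasOutNeighbourIn? S v = any? λ j → arc? v j ×-dec j ∈? S

  Stable-insert : ∀ {S v} → Stable D (_∈ S) → ¬ HasNeighbourIn S v → Stable D (_∈ ⁅ v ⁆ ∪ S)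
  Stable-insert {S} {v} S-stable v≁S a b a∈ b∈ with x∈p∪q⁻ ⁅ v ⁆ S a∈ | x∈p∪q⁻ ⁅ v ⁆ S b∈
  ... | inj₁ a∈v | inj₁ b∈v rewrite x∈⁅y⁆⇒x≡y v a∈v | x∈⁅y⁆⇒x≡y v b∈v = adj-irrefl
  ... | inj₁ a∈v | inj₂ b∈S rewrite x∈⁅y⁆⇒x≡y v a∈v = λ vb → v≁S (b , vb , b∈S)
  ... | inj₂ a∈S | inj₁ b∈v rewrite x∈⁅y⁆⇒x≡y v b∈v = λ av → v≁S (a , swap av , a∈S)
  ... | inj₂ a∈S | inj₂ b∈S = S-stable a b a∈S b∈S

  record StableExtension (S : Subset n) (L : List (Fin n)) : Set where
    field
      set     : Subset n
      stable  : Stable D (_∈ set)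
      extends : S ⊆ set
      bounded : ∀ {v} → v ∈ set → v ∈ S ⊎ v ∈ₗ L
      maximal : ∀ {v} → v ∈ₗ L → v ∈ set ⊎ HasNeighbourIn set v

  extend : ∀ {S} → Stable D (_∈ S) → (L : List (Fin n)) → StableExtension S L
  extend {S} S-stable [] = record
    { set = S ; stable = S-stable ; extends = id ; bounded = inj₁ ; maximal = λ () }
  extend {S} S-stable (v ∷ L) with hasNeighbourIn? S v
  ... | yes (j , vj , j∈S) = record
    { set = set ; stable = stable ; extends = extends
    ; bounded = Sum.map₂ there ∘ bounded
    ; maximal = λ { (here refl) → inj₂ (j , vj , extends j∈S) ; (there w∈L) → maximal w∈L }
    }
    where open StableExtension (extend S-stable L)
  ... | no v≁S = record
    { set = set ; stable = stable
    ; extends = extends ∘ q⊆p∪q ⁅ v ⁆ S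
    ; bounded = λ w∈ → Sum.[ Sum.[ inj₂ ∘ here ∘ x∈⁅y⁆⇒x≡y v , inj₁ ] ∘ x∈p∪q⁻ ⁅ v ⁆ S , inj₂ ∘ there ]
                          (bounded w∈)
    ; maximal = λ { (here refl) → inj₁ (extends (p⊆p∪q S (x∈⁅x⁆ v))) ; (there w∈L) → maximal w∈L }
    }
    where open StableExtension (extend (Stable-insert S-stable v≁S) L)

  -- ∁ T is a strong vertex cover in the sense of Pitones, Reyes and Toledo.
  StrongCoverComplement : Subset n → Set
  StrongCoverComplement T = ∀ {i} → i ∉ T →
    HasNeighbourIn T i ⊎ ∃[ j ] (Arc D j i × j ∉ T × InVplus D j × ¬ HasOutNeighbourIn T j)

  -- The monomial m with (I(D) : m) = P_(∁ T): at full weight on T, an arc from v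
  -- into T completes a generator as soon as x_v divides u, and the exponent
  -- w v ∸ 1 elsewhere lets a single factor x_v complete x_v^(w v).
  colonMonomial : Subset n → Monomial D
  colonMonomial T v with v ∈? T | hasOutNeighbourIn? T v
  ... | yes _ | _     = weight v
  ... | no _  | yes _ = 0
  ... | no _  | no _  = weight v ∸ 1

  module _ {T : Subset n} {v : Fin n} where

    colonMonomial-∈ : v ∈ T → colonMonomial T v ≡ weight v
    colonMonomial-∈ v∈T with v ∈? T
    ... | yes _   = refl
    ... | no v∉T = contradiction v∈T v∉T

    colonMonomial-tail : v ∉ T → HasOutNeighbourIn T v → colonMonomial T v ≡ 0
    colonMonomial-tail v∉T out with v ∈? T | hasOutNeighbourIn? T v
    ... | yes v∈T | _        = contradiction v∈T v∉T
    ... | no _    | yes _    = refl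
    ... | no _    | no ¬out  = contradiction out ¬out

    colonMonomial-sink : v ∉ T → ¬ HasOutNeighbourIn T v → colonMonomial T v ≡ weight v ∸ 1
    colonMonomial-sink v∉T ¬out with v ∈? T | hasOutNeighbourIn? T v
    ... | yes v∈T | _        = contradiction v∈T v∉T
    ... | no _    | yes out  = contradiction out ¬out
    ... | no _    | no _     = refl

    colonMonomial-∉ : v ∉ T → colonMonomial T v < weight v
    colonMonomial-∉ v∉T with v ∈? T | hasOutNeighbourIn? T v
    ... | yes v∈T | _     = contradiction v∈T v∉T
    ... | no _    | yes _ = wpos v
    ... | no _    | no _  = ∸-monoʳ-< (s≤s z≤n) (wpos v)

  module _ {T : Subset n} (T-stable : Stable D (_∈ T)) (T-strong : StrongCoverComplement T) where

    private
      m : Monomial D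
      m = colonMonomial T

    arc-meets-∁ : ∀ {a b} → Arc D a b → b ∉ T ⊎ (a ∉ T × HasOutNeighbourIn T a)
    arc-meets-∁ {a} {b} a→b with b ∈? T
    ... | no b∉T  = inj₁ b∉T
    ... | yes b∈T = inj₂ ((λ a∈T → T-stable a b a∈T b∈T (inj₁ a→b)) , b , a→b , b∈T)

    colon⊆P : ∀ u → InI D (_·_ D u m) → InP D (∁ T) u
    colon⊆P u (a , b , a→b , a-hit , b-hit) with arc-meets-∁ a→b
    ... | inj₁ b∉T = b , x∉p⇒x∈∁p b∉T , m<n⇒n≤o+m⇒0<o (colonMonomial-∉ b∉T) b-hit
    ... | inj₂ (a∉T , out) = a , x∉p⇒x∈∁p a∉T , subst (0 <_) ua+ma≡ua a-hit
      where
      ua+ma≡ua : u a + m a ≡ u a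
      ua+ma≡ua = trans (cong (u a +_) (colonMonomial-tail a∉T out)) (+-identityʳ (u a))

    entered-from-support : ∀ {i} → i ∉ T → ¬ HasOutNeighbourIn T i → ∃[ j ] (Arc D j i × 0 < m j)
    entered-from-support i∉T ¬out with T-strong i∉T
    ... | inj₁ (j , inj₁ i→j , j∈T) = contradiction (j , i→j , j∈T) ¬out
    ... | inj₁ (j , inj₂ j→i , j∈T) = j , j→i , subst (0 <_) (sym (colonMonomial-∈ j∈T)) (wpos j)
    ... | inj₂ (j , j→i , j∉T , j⁺ , ¬out-j) =
      j , j→i , subst (0 <_) (sym (colonMonomial-sink j∉T ¬out-j)) (m<n⇒0<n∸m j⁺)

    cover-hit⇒colon : ∀ u {i} → i ∉ T → 0 < u i → InI D (_·_ D u m)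
    cover-hit⇒colon u {i} i∉T 0<ui with hasOutNeighbourIn? T i
    ... | yes (j , i→j , j∈T) =
      i , j , i→j , ≤-trans 0<ui (m≤m+n _ _) , subst (_≤ u j + m j) (colonMonomial-∈ j∈T) (m≤n+m _ _)
    ... | no ¬out with entered-from-support i∉T ¬out
    ...   | j , j→i , 0<mj = j , i , j→i , ≤-trans 0<mj (m≤n+m _ _) , wi≤ui+mi
      where
      wi≤ui+mi : weight i ≤ u i + m i
      wi≤ui+mi = subst (weight i ≤_) (cong (u i +_) (sym (colonMonomial-sink i∉T ¬out)))
                   (≤-trans (m≤n+m∸n (weight i) 1) (+-monoˡ-≤ (weight i ∸ 1) 0<ui))

    P⊆colon : ∀ u → InP D (∁ T) u → InI D (_·_ D u m)
    P⊆colon u (i , i∈∁T , 0<ui) = cover-hit⇒colon u (x∈∁p⇒x∉p i∈∁T) 0<ui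

    Ass-∁ : Ass D (∁ T)
    Ass-∁ = m , λ u → colon⊆P u , P⊆colon u

module Lemma5p3 {n : ℕ} (D : WOG n) {z y x : Fin n} (z→y : Arc D z y) (y→x : Arc D y x)
  (y⁺ : InVplus D y) (f : Fin n → Fin n)
  (hf : ∀ v → Adj D x v → v ≢ y → Adj D v (f v) × WOG.arc D y (f v) ≡ false)
  (S-stable : Stable D (InS D z x y f)) where
  open WOG D

  inS? : Decidable (InS D z x y f)
  inS? v = v ≟ z ⊎-dec v ≟ x ⊎-dec any? λ u → adj? D x u ×-dec ¬? (u ≟ y) ×-dec f u ≟ v

  S₀ : Subset n
  S₀ = toSubset inS?

  S₀-stable : Stable D (_∈ S₀)
  S₀-stable = Stable-⊆ D (∈-toSubset⁻ {P? = inS?}) S-stable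

  outsideN⁺y : List (Fin n)
  outsideN⁺y = filter (¬? ∘ arc? D y) (allFin n)

  module E₁ = StableExtension (extend D S₀-stable outsideN⁺y)
  module E₂ = StableExtension (extend D E₁.stable (allFin n))

  S₁ S₂ T : Subset n
  S₁ = E₁.set
  S₂ = E₂.set
  T = S₁ - x

  T⊆S₁ : T ⊆ S₁
  T⊆S₁ = p─q⊆p S₁ ⁅ x ⁆

  v∈S₀∧v≢x⇒v∈T : ∀ {v} → InS D z x y f v → v ≢ x → v ∈ T
  v∈S₀∧v≢x⇒v∈T v∈S₀ = x∈p∧x≢y⇒x∈p-y (E₁.extends (∈-toSubset⁺ v∈S₀))

  x∈S₁ : x ∈ S₁
  x∈S₁ = E₁.extends (∈-toSubset⁺ (inj₂ (inj₁ refl)))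

  y∉T : y ∉ T
  y∉T y∈T = E₁.stable y x (T⊆S₁ y∈T) x∈S₁ (inj₁ y→x)

  ¬y→T : ¬ HasOutNeighbourIn D T y
  ¬y→T (k , y→k , k∈T) with E₁.bounded (T⊆S₁ k∈T)
  ... | inj₂ k∈outside = proj₂ (∈-filter⁻ (¬? ∘ arc? D y) {xs = allFin n} k∈outside) y→k
  ... | inj₁ k∈S₀ with ∈-toSubset⁻ k∈S₀
  ...   | inj₁ refl                        = ¬Arc D (oneway z y z→y) y→k
  ...   | inj₂ (inj₁ refl)                 = x∈p-y⇒x≢y k∈T refl
  ...   | inj₂ (inj₂ (u , x~u , u≢y , refl)) = ¬Arc D (proj₂ (hf u x~u u≢y)) y→k

  x~i⇒i~T : ∀ {i} → Adj D x i → HasNeighbourIn D T i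
  x~i⇒i~T {i} x~i with i ≟ y
  ... | yes refl = z , inj₂ z→y , v∈S₀∧v≢x⇒v∈T (inj₁ refl) z≢x
    where
    z≢x : z ≢ x
    z≢x refl = ¬Arc D (oneway z y z→y) y→x
  ... | no i≢y with hf i x~i i≢y
  ...   | i~fi , y↛fi = f i , i~fi , v∈S₀∧v≢x⇒v∈T (inj₂ (inj₂ (i , x~i , i≢y , refl))) fi≢x
    where
    fi≢x : f i ≢ x
    fi≢x fi≡x = ¬Arc D y↛fi (subst (Arc D y) (sym fi≡x) y→x)

  T-strong : StrongCoverComplement D T
  T-strong {i} i∉T with i ≟ x | arc? D y i
  ... | yes refl | _     = inj₂ (y , y→x , y∉T , y⁺ , ¬y→T)
  ... | no _     | yes y→i = inj₂ (y , y→i , y∉T , y⁺ , ¬y→T)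
  ... | no i≢x   | no y↛i with E₁.maximal (∈-filter⁺ (¬? ∘ arc? D y) (∈-allFin i) y↛i)
  ...   | inj₁ i∈S₁ = contradiction (x∈p∧x≢y⇒x∈p-y i∈S₁ i≢x) i∉T
  ...   | inj₂ (j , i~j , j∈S₁) with j ≟ x
  ...     | yes refl = inj₁ (x~i⇒i~T (swap i~j))
  ...     | no j≢x   = inj₁ (j , i~j , x∈p∧x≢y⇒x∈p-y j∈S₁ j≢x)

  S₂-strong : StrongCoverComplement D S₂
  S₂-strong {i} i∉S₂ with E₂.maximal (∈-allFin i)
  ... | inj₁ i∈S₂  = contradiction i∈S₂ i∉S₂
  ... | inj₂ i~S₂ = inj₁ i~S₂

  T-stable : Stable D (_∈ T)
  T-stable = Stable-⊆ D T⊆S₁ E₁.stable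

  T⊂S₂ : T ⊂ S₂
  T⊂S₂ = ⊂-⊆-trans (x∈p⇒p-x⊂p x∈S₁) E₂.extends

lemma5p3 : ∀ {n : ℕ} (D : WOG n) (z y x : Fin n) →
    Arc D z y → Arc D y x → InVplus D y →
    (f : Fin n → Fin n) →
    (∀ v → Adj D x v → v ≢ y → Adj D v (f v) × WOG.arc D y (f v) ≡ false) →
    Stable D (InS D z x y f) →
    ¬ Unmixed D
lemma5p3 D z y x z→y y→x y⁺ f hf S-stable unmixed =
  <-irrefl (unmixed (∁ S₂) (∁ T) (Ass-∁ D E₂.stable S₂-strong) (Ass-∁ D T-stable T-strong))
           (p⊂q⇒∣p∣<∣q∣ (p⊂q⇒∁p⊃∁q T⊂S₂))
  where
  open Lemma5p3 D z→y y→x y⁺ f hf S-stable
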